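{- Let $G$ be an undirected graph (loops allowed) on $\{1,\dots,r-1\}$ that generates a fusion ring, with $H$ a $3$-uniform hypergraph such that $(G,H)$ is the associated pair of a self-dual multiplicity-free fusion ring. For distinct vertices $i,j$ let $w_{ij}$ be the number of $k$ with $\{i,j,k\}\in H$. Then: (1) if $i\not\sim j$, then $w_{ij}=1+|N(i)\cap N(j)|$; (2) if $i\sim j$ and $(N(i)\cap N(j))\setminus\{i,j\}=\emptyset$, then either $w_{ij}=0$ and exactly one of $i,j$ has a loop, or $w_{ij}=1$ and both $i$ and $j$ have loops; (3) if $i\sim j$ and neither $i$ nor $j$ has a loop, then $i$ and $j$ have a common neighbour.
   Context: A fusion ring of rank $r$ (commutative) is a commutative unital ring, free as a $\mathbb{Z}$-module on a basis $X_0=1,X_1,\dots,X_{r-1}$, with $X_iX_j=\sum_k N_{ij}^kX_k$, $N_{ij}^k\in\mathbb{Z}_{\ge0}$, and an involution $i\mapsto i^*$ with $N_{ij}^0=\delta_{i,j^*}$ and $N_{ij}^k=N_{jk^*}^{i^*}=N_{j^*i^*}^{k^*}$. It is self-dual if $i^*=i$ for all $i$, multiplicity-free if all $N_{ij}^k\in\{0,1\}$. For such a ring the associated digraph $D$ on $\{1,\dots,r-1\}$ has a loop at $i$ iff $N_{ii}^i=1$ and, for $i\ne j$, an arc $(i,j)$ iff $N_{ii}^j=1$; the associated $3$-uniform hypergraph $H$ has hyperedge $\{i,j,k\}$ (distinct) iff $N_{ij}^k=1$. A digraph generates a fusion ring if it is the associated digraph of some self-dual multiplicity-free fusion ring. An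 undirected graph (possibly with loops) is identified with the digraph having arcs $(i,j),(j,i)$ for each edge $\{i,j\}$, $i\neq j$. For distinct $i,j$, $i\sim j$ means $\{i,j\}$ is an edge; $N(v)=\{u:\{u,v\}\text{ is an edge}\}$, which contains $v$ exactly when $v$ has a loop. -}

module Defs where

open import Data.Nat using (ℕ; zero; suc; _+_; _*_; _≤_)
open import Data.Fin using (Fin; zero; suc; _≟_)
open import Data.Bool using (Bool; true; false; if_then_else_)
open import Relation.Nullary.Decidable using (⌊_⌋)
open import Relation.Binary.PropositionalEquality using (_≡_; _≢_)
open import Function.Bundles using (_⇔_)

∑ : ∀ {m} → (Fin m → ℕ) → ℕ
∑ {zero}  f = 0
∑ {suc m} f = f zero + ∑ (λ i → f (suc i))

count : ∀ {m} → (Fin m → Bool) → ℕ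
count {zero}  p = 0
count {suc m} p = (if p zero then 1 else 0) + count (λ i → p (suc i))

δ : ∀ {m} → Fin m → Fin m → ℕ
δ i j = if ⌊ i ≟ j ⌋ then 1 else 0

-- A commutative, self-dual (i* = i), multiplicity-free fusion ring of rank
-- suc n, with basis X₀ = 1 (index zero), X₁, …, Xₙ, given by its structure
-- constants N i j k = N_{ij}^k, where X_i X_j = ∑_k N_{ij}^k X_k.
record SDMFFusionRing (n : ℕ) : Set where
  field
    N         : Fin (suc n) → Fin (suc n) → Fin (suc n) → ℕ
    multFree  : ∀ i j k → N i j k ≤ 1
    unitL     : ∀ j k → N zero j k ≡ δ j k
    comm      : ∀ i j k → N i j k ≡ N j i k
    assoc     : ∀ i j k l →
                ∑ (λ m → N i j m * N m k l) ≡ ∑ (λ m → N j k m * N i m l)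
    dual0     : ∀ i j → N i j zero ≡ δ i j
    -- N_{ij}^k = N_{j k*}^{i*} = N_{j* i*}^{k*} with * = identity
    frob₁     : ∀ i j k → N i j k ≡ N j k i
    frob₂     : ∀ i j k → N i j k ≡ N j i k

-- Undirected graph (loops allowed) on vertex set Fin n (vertex v stands for
-- the basis index suc v ∈ {1,…,r-1}); adj v v = true means a loop at v.
record Graph (n : ℕ) : Set where
  field
    adj     : Fin n → Fin n → Bool
    adjSym  : ∀ u v → adj u v ≡ adj v u

-- A 3-uniform hypergraph on Fin n: only the values on triples of distinct
-- vertices are meaningful (membership of the hyperedge {i,j,k}).
Hypergraph : ℕ → Set
Hypergraph n = Fin n → Fin n → Fin n → Bool

module _ {n : ℕ} (R : SDMFFusionRing n) where
  open SDMFFusionRing R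

  IsAssocGraph : Graph n → Set
  IsAssocGraph G = ∀ i j → (N (suc i) (suc i) (suc j) ≡ 1) ⇔ (Graph.adj G i j ≡ true)

  IsAssocHypergraph : Hypergraph n → Set
  IsAssocHypergraph H = ∀ i j k → i ≢ j → j ≢ k → i ≢ k →
    (H i j k ≡ true) ⇔ (N (suc i) (suc j) (suc k) ≡ 1)

w : ∀ {n} → Hypergraph n → Fin n → Fin n → ℕ
w H i j = count (λ k → if ⌊ k ≟ i ⌋ then false else
                        if ⌊ k ≟ j ⌋ then false else H i j k)

-- |N(i) ∩ N(j)|, where N(v) = {u : adj u v} (contains v iff v has a loop).
commonNbhdSize : ∀ {n} → Graph n → Fin n → Fin n → ℕ
commonNbhdSize G i j = count (λ u → if Graph.adj G u i then Graph.adj G u j else false)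

-- Expand the coefficient of X_j in (X_i X_i) X_j = X_i (X_i X_j).  On the left,
-- the term through X₀ contributes 1 and the term through X_u contributes
-- N_{ii}^u N_{jj}^u = [u ∈ N(i) ∩ N(j)], giving 1 + |N(i) ∩ N(j)|.  On the right,
-- multiplicity-freeness makes the sum ∑_m (N_{ij}^m)², i.e. the number of m with
-- N_{ij}^m = 1; the terms m = i and m = j each contribute [i ∼ j] and the others
-- contribute w_{ij}.  Hence 2[i ∼ j] + w_{ij} = 1 + |N(i) ∩ N(j)|, from which the
-- three claims are read off.
module Submission where

open import Defs
open import Data.Nat using (ℕ; zero; suc; _+_; _*_; _≤_; z≤n; s≤s)
open import Data.Nat.Properties using (+-identityʳ; suc-injective; +-commutativeSemigroup)
open import Algebra.Properties.CommutativeSemigroup +-commutativeSemigroup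
  using () renaming (interchange to +-interchange)
open import Data.Fin using (Fin; zero; suc; _≟_)
open import Data.Bool using (Bool; true; false; _xor_; if_then_else_)
open import Data.Product using (_×_; _,_; ∃-syntax)
open import Data.Sum using (_⊎_; inj₁; inj₂)
open import Relation.Nullary using (¬_; yes; no)
open import Relation.Nullary.Decidable using (⌊_⌋)
open import Relation.Binary.PropositionalEquality
  using (_≡_; _≢_; refl; sym; trans; cong; cong₂; subst; module ≡-Reasoning)
open import Function.Bundles using (_⇔_; Equivalence)
open import Function.Properties.Equivalence using () renaming (sym to ⇔-sym)
import Data.Fin.Properties as Fin

𝟙 : Bool → ℕ
𝟙 b = if b then 1 else 0

𝟙-∧ : ∀ a b → 𝟙 a * 𝟙 b ≡ 𝟙 (if a then b else false)
𝟙-∧ true  b = +-identityʳ (𝟙 b)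
𝟙-∧ false b = refl

≤1⇒≡𝟙 : ∀ {x b} → x ≤ 1 → (x ≡ 1 ⇔ b ≡ true) → x ≡ 𝟙 b
≤1⇒≡𝟙 {b = true}  _         x≡1⇔b = Equivalence.from x≡1⇔b refl
≤1⇒≡𝟙 {b = false} z≤n       _     = refl
≤1⇒≡𝟙 {b = false} (s≤s z≤n) x≡1⇔b with () ← Equivalence.to x≡1⇔b refl

≤1⇒*-idem : ∀ {x} → x ≤ 1 → x * x ≡ x
≤1⇒*-idem z≤n       = refl
≤1⇒*-idem (s≤s z≤n) = refl

δ-refl : ∀ {m} (i : Fin m) → δ i i ≡ 1
δ-refl i with i ≟ i
... | yes _   = refl
... | no i≢i  with () ← i≢i refl

δ-≢ : ∀ {m} {i j : Fin m} → i ≢ j → δ i j ≡ 0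
δ-≢ {i = i} {j} i≢j with i ≟ j
... | yes i≡j with () ← i≢j i≡j
... | no _    = refl

∑-cong : ∀ {m} {f g : Fin m → ℕ} → (∀ k → f k ≡ g k) → ∑ f ≡ ∑ g
∑-cong {zero}  f≗g = refl
∑-cong {suc m} f≗g = cong₂ _+_ (f≗g zero) (∑-cong (λ k → f≗g (suc k)))

∑-zero : ∀ m → ∑ {m} (λ _ → 0) ≡ 0
∑-zero zero    = refl
∑-zero (suc m) = ∑-zero m

∑-distrib-+ : ∀ {m} (f g : Fin m → ℕ) → ∑ (λ k → f k + g k) ≡ ∑ f + ∑ g
∑-distrib-+ {zero}  f g = refl
∑-distrib-+ {suc m} f g =
  trans (cong (f zero + g zero +_) (∑-distrib-+ (λ k → f (suc k)) (λ k → g (suc k))))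
        (+-interchange (f zero) (g zero) (∑ (λ k → f (suc k))) (∑ (λ k → g (suc k))))

spike : ∀ {m} → Fin m → ℕ → Fin m → ℕ
spike i x k = if ⌊ k ≟ i ⌋ then x else 0

⌊suc≟suc⌋ : ∀ {m} (k i : Fin m) → ⌊ suc k ≟ suc i ⌋ ≡ ⌊ k ≟ i ⌋
⌊suc≟suc⌋ k i with k ≟ i
... | yes _ = refl
... | no _  = refl

∑-spike : ∀ {m} (i : Fin m) x → ∑ (spike i x) ≡ x
∑-spike {suc m} zero    x = trans (cong (x +_) (∑-zero m)) (+-identityʳ x)
∑-spike {suc m} (suc i) x =
  trans (∑-cong (λ k → cong (if_then x else 0) (⌊suc≟suc⌋ k i))) (∑-spike i x)

∑-spike₂ : ∀ {m} (i j : Fin m) x y (f : Fin m → ℕ) →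
           ∑ (λ k → spike i x k + spike j y k + f k) ≡ x + y + ∑ f
∑-spike₂ i j x y f = begin
  ∑ (λ k → spike i x k + spike j y k + f k)
    ≡⟨ ∑-distrib-+ (λ k → spike i x k + spike j y k) f ⟩
  ∑ (λ k → spike i x k + spike j y k) + ∑ f
    ≡⟨ cong (_+ ∑ f) (∑-distrib-+ (spike i x) (spike j y)) ⟩
  ∑ (spike i x) + ∑ (spike j y) + ∑ f
    ≡⟨ cong₂ (λ a b → a + b + ∑ f) (∑-spike i x) (∑-spike j y) ⟩
  x + y + ∑ f ∎
  where open ≡-Reasoning

count≡∑𝟙 : ∀ {m} (p : Fin m → Bool) → count p ≡ ∑ (λ k → 𝟙 (p k))
count≡∑𝟙 {zero}  p = refl
count≡∑𝟙 {suc m} p = cong (𝟙 (p zero) +_) (count≡∑𝟙 (λ k → p (suc k)))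

count≢0⇒∃ : ∀ {m} (p : Fin m → Bool) {c} → count p ≡ suc c → ∃[ k ] p k ≡ true
count≢0⇒∃ {suc m} p count≡ with p zero in p₀
... | true  = zero , p₀
... | false with k , pk ← count≢0⇒∃ (λ k → p (suc k)) count≡ = suc k , pk

module _ {n : ℕ} (R : SDMFFusionRing n) where
  open SDMFFusionRing R

  N-swap₂₃ : ∀ a b c → N a b c ≡ N a c b
  N-swap₂₃ a b c = trans (comm a b c) (frob₁ b a c)

  ∑NᵢᵢNⱼⱼ≡∑Nᵢⱼ : ∀ i j → ∑ (λ m → N i i m * N j j m) ≡ ∑ (λ m → N i j m)
  ∑NᵢᵢNⱼⱼ≡∑Nᵢⱼ i j = begin
    ∑ (λ m → N i i m * N j j m)  ≡⟨ ∑-cong (λ m → cong (N i i m *_) (sym (frob₁ m j j))) ⟩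
    ∑ (λ m → N i i m * N m j j)  ≡⟨ assoc i i j j ⟩
    ∑ (λ m → N i j m * N i m j)  ≡⟨ ∑-cong (λ m → cong (N i j m *_) (sym (N-swap₂₃ i j m))) ⟩
    ∑ (λ m → N i j m * N i j m)  ≡⟨ ∑-cong (λ m → ≤1⇒*-idem (multFree i j m)) ⟩
    ∑ (λ m → N i j m)            ∎
    where open ≡-Reasoning

  module _ (G : Graph n) (isAssocG : IsAssocGraph R G) where
    open Graph G

    Nᵢᵢᵤ≡adj : ∀ i u → N (suc i) (suc i) (suc u) ≡ 𝟙 (adj i u)
    Nᵢᵢᵤ≡adj i u = ≤1⇒≡𝟙 (multFree _ _ _) (isAssocG i u)

    commonNbr : Fin n → Fin n → Fin n → Bool
    commonNbr i j u = if adj u i then adj u j else false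

    ∑NᵢᵢNⱼⱼ≡1+commonNbhdSize : ∀ i j →
      ∑ (λ m → N (suc i) (suc i) m * N (suc j) (suc j) m) ≡ 1 + commonNbhdSize G i j
    ∑NᵢᵢNⱼⱼ≡1+commonNbhdSize i j = cong₂ _+_ through-unit (begin
      ∑ (λ u → N (suc i) (suc i) (suc u) * N (suc j) (suc j) (suc u))
        ≡⟨ ∑-cong through-Xᵤ ⟩
      ∑ (λ u → 𝟙 (commonNbr i j u))  ≡⟨ sym (count≡∑𝟙 (commonNbr i j)) ⟩
      commonNbhdSize G i j           ∎)
      where
      open ≡-Reasoning
      through-unit : N (suc i) (suc i) zero * N (suc j) (suc j) zero ≡ 1
      through-unit rewrite dual0 (suc i) (suc i) | dual0 (suc j) (suc j)
                         | δ-refl (suc i) | δ-refl (suc j) = refl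
      through-Xᵤ : ∀ u → N (suc i) (suc i) (suc u) * N (suc j) (suc j) (suc u)
                         ≡ 𝟙 (commonNbr i j u)
      through-Xᵤ u rewrite Nᵢᵢᵤ≡adj i u | Nᵢᵢᵤ≡adj j u | adjSym i u | adjSym j u =
        𝟙-∧ (adj u i) (adj u j)

    commonNbhdSize≡loops : ∀ {i j} → i ≢ j → adj i j ≡ true →
      (∀ u → u ≢ i → u ≢ j → ¬ (adj u i ≡ true × adj u j ≡ true)) →
      commonNbhdSize G i j ≡ 𝟙 (adj i i) + 𝟙 (adj j j)
    commonNbhdSize≡loops {i} {j} i≢j i∼j only-i-j = begin
      commonNbhdSize G i j                ≡⟨ count≡∑𝟙 (commonNbr i j) ⟩
      ∑ (λ u → 𝟙 (commonNbr i j u))      ≡⟨ ∑-cong split ⟩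
      ∑ (λ u → spike i a u + spike j b u + 0)  ≡⟨ ∑-spike₂ i j a b (λ _ → 0) ⟩
      a + b + ∑ {n} (λ _ → 0)            ≡⟨ cong (a + b +_) (∑-zero n) ⟩
      a + b + 0                          ≡⟨ +-identityʳ (a + b) ⟩
      a + b                              ∎
      where
      open ≡-Reasoning
      a = 𝟙 (adj i i)
      b = 𝟙 (adj j j)
      𝟙-if-true : ∀ c → 𝟙 (if c then true else false) ≡ 𝟙 c + 0 + 0
      𝟙-if-true true  = refl
      𝟙-if-true false = refl
      𝟙-∧-false : ∀ c d → ¬ (c ≡ true × d ≡ true) → 𝟙 (if c then d else false) ≡ 0
      𝟙-∧-false true  true  ¬c∧d with () ← ¬c∧d (refl , refl)
      𝟙-∧-false true  false _    = refl
      𝟙-∧-false false d     _    = refl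
      split : ∀ u → 𝟙 (commonNbr i j u) ≡ spike i a u + spike j b u + 0
      split u with u ≟ i | u ≟ j
      ... | yes refl | yes refl with () ← i≢j refl
      ... | yes refl | no _ rewrite i∼j = 𝟙-if-true (adj u u)
      ... | no _ | yes refl rewrite adjSym u i | i∼j = sym (+-identityʳ _)
      ... | no u≢i | no u≢j = 𝟙-∧-false (adj u i) (adj u j) (only-i-j u u≢i u≢j)

    module _ (H : Hypergraph n) (isAssocH : IsAssocHypergraph R H) where

      ∑Nᵢⱼ≡2adj+w : ∀ {i j} → i ≢ j →
        ∑ (λ m → N (suc i) (suc j) m) ≡ 𝟙 (adj i j) + 𝟙 (adj i j) + w H i j
      ∑Nᵢⱼ≡2adj+w {i} {j} i≢j = cong₂ _+_ Nᵢⱼ₀≡0 (begin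
        ∑ (λ k → N (suc i) (suc j) (suc k))     ≡⟨ ∑-cong split ⟩
        ∑ (λ k → spike i a k + spike j a k + 𝟙 (hyperedge k))
                                                ≡⟨ ∑-spike₂ i j a a _ ⟩
        a + a + ∑ (λ k → 𝟙 (hyperedge k))       ≡⟨ cong (a + a +_) (sym (count≡∑𝟙 hyperedge)) ⟩
        a + a + w H i j                         ∎)
        where
        open ≡-Reasoning
        a = 𝟙 (adj i j)
        Nᵢⱼ₀≡0 : N (suc i) (suc j) zero ≡ 0
        Nᵢⱼ₀≡0 = trans (dual0 _ _) (δ-≢ (λ si≡sj → i≢j (Fin.suc-injective si≡sj)))
        hyperedge : Fin n → Bool
        hyperedge k = if ⌊ k ≟ i ⌋ then false else if ⌊ k ≟ j ⌋ then false else H i j k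
        split : ∀ k → N (suc i) (suc j) (suc k) ≡ spike i a k + spike j a k + 𝟙 (hyperedge k)
        split k with k ≟ i | k ≟ j
        ... | yes refl | yes refl with () ← i≢j refl
        ... | yes refl | no _ = begin
          N (suc k) (suc j) (suc k)  ≡⟨ N-swap₂₃ (suc k) (suc j) (suc k) ⟩
          N (suc k) (suc k) (suc j)  ≡⟨ Nᵢᵢᵤ≡adj k j ⟩
          a                          ≡⟨ sym (trans (+-identityʳ _) (+-identityʳ _)) ⟩
          a + 0 + 0                  ∎
        ... | no _ | yes refl = begin
          N (suc i) (suc k) (suc k)  ≡⟨ frob₁ (suc i) (suc k) (suc k) ⟩
          N (suc k) (suc k) (suc i)  ≡⟨ Nᵢᵢᵤ≡adj k i ⟩
          𝟙 (adj k i)                ≡⟨ cong 𝟙 (adjSym k i) ⟩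
          a                          ≡⟨ sym (+-identityʳ a) ⟩
          0 + a + 0                  ∎
        ... | no k≢i | no k≢j = ≤1⇒≡𝟙 (multFree _ _ _)
          (⇔-sym (isAssocH i j k i≢j (λ j≡k → k≢j (sym j≡k)) (λ i≡k → k≢i (sym i≡k))))

      2adj+w≡1+commonNbhdSize : ∀ {i j} → i ≢ j →
        𝟙 (adj i j) + 𝟙 (adj i j) + w H i j ≡ 1 + commonNbhdSize G i j
      2adj+w≡1+commonNbhdSize {i} {j} i≢j = begin
        𝟙 (adj i j) + 𝟙 (adj i j) + w H i j                  ≡⟨ sym (∑Nᵢⱼ≡2adj+w i≢j) ⟩
        ∑ (λ m → N (suc i) (suc j) m)                        ≡⟨ sym (∑NᵢᵢNⱼⱼ≡∑Nᵢⱼ (suc i) (suc j)) ⟩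
        ∑ (λ m → N (suc i) (suc i) m * N (suc j) (suc j) m)  ≡⟨ ∑NᵢᵢNⱼⱼ≡1+commonNbhdSize i j ⟩
        1 + commonNbhdSize G i j                             ∎
        where open ≡-Reasoning

      nonadjacent⇒w≡1+commonNbhdSize : ∀ {i j} → i ≢ j → adj i j ≡ false →
        w H i j ≡ 1 + commonNbhdSize G i j
      nonadjacent⇒w≡1+commonNbhdSize {i} {j} i≢j i≁j =
        subst (λ b → 𝟙 b + 𝟙 b + w H i j ≡ 1 + commonNbhdSize G i j) i≁j
              (2adj+w≡1+commonNbhdSize i≢j)

      adjacent⇒2+w≡1+commonNbhdSize : ∀ {i j} → i ≢ j → adj i j ≡ true →
        2 + w H i j ≡ 1 + commonNbhdSize G i j
      adjacent⇒2+w≡1+commonNbhdSize {i} {j} i≢j i∼j =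
        subst (λ b → 𝟙 b + 𝟙 b + w H i j ≡ 1 + commonNbhdSize G i j) i∼j
              (2adj+w≡1+commonNbhdSize i≢j)

      adjacent-without-common-nbr⇒loops : ∀ {i j} → i ≢ j → adj i j ≡ true →
        (∀ u → u ≢ i → u ≢ j → ¬ (adj u i ≡ true × adj u j ≡ true)) →
        (w H i j ≡ 0 × (adj i i xor adj j j) ≡ true)
        ⊎ (w H i j ≡ 1 × adj i i ≡ true × adj j j ≡ true)
      adjacent-without-common-nbr⇒loops {i} {j} i≢j i∼j only-i-j =
        cases (w H i j) (adj i i) (adj j j)
          (trans (adjacent⇒2+w≡1+commonNbhdSize i≢j i∼j)
                 (cong suc (commonNbhdSize≡loops i≢j i∼j only-i-j)))
        where
        cases : ∀ x a b → 2 + x ≡ 1 + (𝟙 a + 𝟙 b) →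
          (x ≡ 0 × (a xor b) ≡ true) ⊎ (x ≡ 1 × a ≡ true × b ≡ true)
        cases x true  true  refl = inj₂ (refl , refl , refl)
        cases x true  false refl = inj₁ (refl , refl)
        cases x false true  refl = inj₁ (refl , refl)

      adjacent-loopless⇒common-nbr : ∀ {i j} → i ≢ j → adj i j ≡ true →
        adj i i ≡ false → adj j j ≡ false →
        ∃[ u ] (u ≢ i × u ≢ j × adj u i ≡ true × adj u j ≡ true)
      adjacent-loopless⇒common-nbr {i} {j} i≢j i∼j i≁i j≁j
        with u , u∈Nᵢ∩Nⱼ ← count≢0⇒∃ (commonNbr i j)
               (sym (suc-injective (adjacent⇒2+w≡1+commonNbhdSize i≢j i∼j)))
        with true ← adj u i in u∼i
        with true ← adj u j in u∼j
        = u , loopless u∼i i≁i , loopless u∼j j≁j , u∼i , u∼j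
        where
        loopless : ∀ {u v} → adj u v ≡ true → adj v v ≡ false → u ≢ v
        loopless u∼v v≁v refl with () ← trans (sym u∼v) v≁v

mainTheorem8 : ∀ {n : ℕ} (R : SDMFFusionRing n) (G : Graph n) (H : Hypergraph n) →
    IsAssocGraph R G → IsAssocHypergraph R H →
    (∀ i j → i ≢ j → Graph.adj G i j ≡ false →
      w H i j ≡ 1 + commonNbhdSize G i j)
    × (∀ i j → i ≢ j → Graph.adj G i j ≡ true →
      (∀ u → u ≢ i → u ≢ j → ¬ (Graph.adj G u i ≡ true × Graph.adj G u j ≡ true)) →
      (w H i j ≡ 0 × (Graph.adj G i i xor Graph.adj G j j) ≡ true)
      ⊎ (w H i j ≡ 1 × Graph.adj G i i ≡ true × Graph.adj G j j ≡ true))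
    × (∀ i j → i ≢ j → Graph.adj G i j ≡ true →
      Graph.adj G i i ≡ false → Graph.adj G j j ≡ false →
      ∃[ u ] (u ≢ i × u ≢ j × Graph.adj G u i ≡ true × Graph.adj G u j ≡ true))
mainTheorem8 R G H isAssocG isAssocH =
  (λ _ _ → nonadjacent⇒w≡1+commonNbhdSize R G isAssocG H isAssocH) ,
  (λ _ _ → adjacent-without-common-nbr⇒loops R G isAssocG H isAssocH) ,
  (λ _ _ → adjacent-loopless⇒common-nbr R G isAssocG H isAssocH)
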